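{- For all integers $n\ge1$ and $0\le h\le n-1$, $$S(n,n-h)=\sum_{i=h+1}^n\binom{n-1}{n-i}p_{i-1,i-1-h}.$$
   Context: $S(n,k)$ is the Stirling number of the second kind (number of partitions of $\{1,\dots,n\}$ into $k$ blocks). For $m,j\ge0$, $p_{m,j}$ denotes the number of set partitions of $\{1,\dots,m\}$ having exactly $j$ blocks of size at least two (with $p_{0,0}=1$). -}

module Defs where

open import Data.Nat using (ℕ; zero; suc; _+_; _∸_; _≤_; _≤?_; _≟_; _⊔_; _<?_)
open import Data.List using (List; []; _∷_; map; concatMap; filter; length; upTo)
open import Data.Nat.ListAction using (sum)
open import Data.Bool using (Bool; true; false)
open import Relation.Nullary using (Dec; yes; no)
open import Relation.Nullary.Decidable using (⌊_⌋)
open import Relation.Binary.PropositionalEquality using (_≡_)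

-- Set partitions of {1,…,m} are encoded by their canonical block labelling
-- (restricted growth string): element i gets the label of its block, where blocks
-- are labelled 0,1,2,… in order of their least element.  A list a₁…aₘ of
-- labels is canonical iff each aᵢ ≤ (1 + max of earlier labels), with a₁ = 0.
-- This is a bijection between set partitions of {1,…,m} and canonical strings.

labellings : ℕ → ℕ → List (List ℕ)
labellings bound zero    = [] ∷ []
labellings bound (suc m) =
  concatMap (λ a → map (a ∷_) (labellings bound m)) (upTo bound)

-- canonical check, given the number c of labels used so far (labels 0..c-1)
canonicalFrom : ℕ → List ℕ → Bool
canonicalFrom c []       = true
canonicalFrom c (a ∷ as) with a <? c
... | yes _ = canonicalFrom c as
... | no  _ with a ≟ c
...   | yes _ = canonicalFrom (suc c) as
...   | no  _ = false

partitions : ℕ → List (List ℕ)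
partitions m = filter (λ s → canonicalFrom 0 s Data.Bool.≟ true) (labellings m m)

blockSize : List ℕ → ℕ → ℕ
blockSize s v = length (filter (λ a → a ≟ v) s)

-- labels that are actually used; a labelling of {1..m} uses labels < m
labelsOf : List ℕ → List ℕ
labelsOf s = filter (λ v → 1 ≤? blockSize s v) (upTo (length s))

numBlocks : List ℕ → ℕ
numBlocks s = length (labelsOf s)

numBigBlocks : List ℕ → ℕ
numBigBlocks s = length (filter (λ v → 2 ≤? blockSize s v) (upTo (length s)))

S : ℕ → ℕ → ℕ
S n k = length (filter (λ s → numBlocks s ≟ k) (partitions n))

p : ℕ → ℕ → ℕ
p m j = length (filter (λ s → numBigBlocks s ≟ j) (partitions m))

-- Σ_{i=a}^{b} f i  (empty when b < a)
sumFromTo : ℕ → ℕ → (ℕ → ℕ) → ℕ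
sumFromTo a b f = sum (map (λ t → f (a + t)) (upTo (suc b ∸ a)))

{-# OPTIONS --safe #-}
-- Read the canonical labellings element by element: each new element joins a singleton block,
-- joins a block of size at least two, or opens a new block.  Keeping track of the numbers of big
-- and singleton blocks only, S and p become solutions of recurrences, which we index by a defect
-- h: the number of elements that join an existing block (for S), resp. that do not turn a
-- singleton into a big block (for p).  Then the right-hand side is the binomial transform
-- Σₘ C(n-1,m) p(m, m-h), and it obeys the Stirling recurrence because of a single exchange
-- identity: an extra singleton either stays a singleton or, once joined, behaves like an extra
-- big block.
module Submission where

open import Defs
open import Data.Nat using (ℕ; _+_; _∸_; _≤_; _*_)
open import Data.Nat.Combinatorics using (_C_)
open import Relation.Binary.PropositionalEquality using (_≡_)

open import Data.Bool using (Bool; true; false; if_then_else_)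
open import Data.Bool.Properties using () renaming (_≟_ to _≟ᵇ_)
open import Data.Empty using (⊥-elim)
open import Data.List using (List; []; _∷_; [_]; _++_; map; concatMap; filter; length; applyUpTo; upTo)
open import Data.List.Properties using (map-++; map-∘; map-cong; ++-assoc; ++-identityʳ; length-++; length-++-≤ˡ)
open import Data.Nat using (zero; suc; pred; _<_; s≤s; s≤s⁻¹; z≤n; _≟_; _≤?_)
open import Data.Nat.Combinatorics using (k>n⇒nCk≡0; nCk+nC[k+1]≡[n+1]C[k+1]; nCk≡nC[n∸k])
open import Data.Nat.ListAction using (sum)
open import Data.Nat.ListAction.Properties using (sum-++)
open import Data.Nat.Properties
open import Data.Nat.Tactic.RingSolver using (solve-∀)
open import Function using (_∘_; id)
open import Relation.Binary.PropositionalEquality using (refl; sym; trans; cong; cong₂; subst; module ≡-Reasoning)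
open import Relation.Nullary using (Dec; yes; no; does; ¬_)

open ≡-Reasoning

χ : ∀ {a} {A : Set a} → Dec A → ℕ
χ d = if does d then 1 else 0

χ-yes : ∀ {a} {A : Set a} (d : Dec A) → A → χ d ≡ 1
χ-yes (yes _) _ = refl
χ-yes (no ¬a) a = ⊥-elim (¬a a)

χ-no : ∀ {a} {A : Set a} (d : Dec A) → ¬ A → χ d ≡ 0
χ-no (yes a) ¬a = ⊥-elim (¬a a)
χ-no (no _)  _  = refl

*-congˡ-nonzero : ∀ u {x y} → (∀ {v} → u ≡ suc v → x ≡ y) → u * x ≡ u * y
*-congˡ-nonzero zero    _ = refl
*-congˡ-nonzero (suc v) e = cong (suc v *_) (e refl)

∑< : ℕ → (ℕ → ℕ) → ℕ
∑< zero    f = 0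
∑< (suc n) f = f 0 + ∑< n (f ∘ suc)

∑-cong : ∀ n {f g : ℕ → ℕ} → (∀ m → m < n → f m ≡ g m) → ∑< n f ≡ ∑< n g
∑-cong zero    e = refl
∑-cong (suc n) e = cong₂ _+_ (e 0 (s≤s z≤n)) (∑-cong n (λ m m<n → e (suc m) (s≤s m<n)))

∑-zero : ∀ n {f : ℕ → ℕ} → (∀ m → m < n → f m ≡ 0) → ∑< n f ≡ 0
∑-zero zero    e = refl
∑-zero (suc n) e = cong₂ _+_ (e 0 (s≤s z≤n)) (∑-zero n (λ m m<n → e (suc m) (s≤s m<n)))

∑-const : ∀ n c → ∑< n (λ _ → c) ≡ n * c
∑-const zero    c = refl
∑-const (suc n) c = cong (c +_) (∑-const n c)

∑-+ : ∀ n (f g : ℕ → ℕ) → ∑< n (λ m → f m + g m) ≡ ∑< n f + ∑< n g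
∑-+ zero    f g = refl
∑-+ (suc n) f g = begin
    (f 0 + g 0) + ∑< n (λ m → f (suc m) + g (suc m))
  ≡⟨ cong ((f 0 + g 0) +_) (∑-+ n (f ∘ suc) (g ∘ suc)) ⟩
    (f 0 + g 0) + (∑< n (f ∘ suc) + ∑< n (g ∘ suc))
  ≡⟨ +-transpose (f 0) (g 0) _ _ ⟩
    (f 0 + ∑< n (f ∘ suc)) + (g 0 + ∑< n (g ∘ suc))
  ∎
  where
  +-transpose : ∀ a b c d → (a + b) + (c + d) ≡ (a + c) + (b + d)
  +-transpose = solve-∀

∑-*ʳ : ∀ n c (f : ℕ → ℕ) → ∑< n (λ m → f m * c) ≡ ∑< n f * c
∑-*ʳ zero    c f = refl
∑-*ʳ (suc n) c f = trans (cong (f 0 * c +_) (∑-*ʳ n c (f ∘ suc))) (sym (*-distribʳ-+ c (f 0) _))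

∑-∷ʳ : ∀ n (f : ℕ → ℕ) → ∑< (suc n) f ≡ ∑< n f + f n
∑-∷ʳ zero    f = +-comm (f 0) 0
∑-∷ʳ (suc n) f = trans (cong (f 0 +_) (∑-∷ʳ n (f ∘ suc))) (sym (+-assoc (f 0) _ _))

∑-split : ∀ h n (f : ℕ → ℕ) → h ≤ n → ∑< n f ≡ ∑< h f + ∑< (n ∸ h) (λ t → f (h + t))
∑-split zero    n       f _         = refl
∑-split (suc h) (suc n) f (s≤s h≤n) =
  trans (cong (f 0 +_) (∑-split h n (f ∘ suc) h≤n)) (sym (+-assoc (f 0) _ _))

∑-drop-zeros : ∀ h n (f : ℕ → ℕ) → h ≤ n → (∀ m → m < h → f m ≡ 0) →
  ∑< n f ≡ ∑< (n ∸ h) (λ t → f (h + t))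
∑-drop-zeros h n f h≤n zeros = trans (∑-split h n f h≤n) (cong (_+ ∑< (n ∸ h) (λ t → f (h + t))) (∑-zero h zeros))

∑-drop-tail : ∀ c n (f : ℕ → ℕ) → c ≤ n → (∀ m → c ≤ m → f m ≡ 0) → ∑< n f ≡ ∑< c f
∑-drop-tail c n f c≤n zeros = begin
    ∑< n f
  ≡⟨ ∑-split c n f c≤n ⟩
    ∑< c f + ∑< (n ∸ c) (λ t → f (c + t))
  ≡⟨ cong (∑< c f +_) (∑-zero (n ∸ c) (λ t _ → zeros (c + t) (m≤m+n c t))) ⟩
    ∑< c f + 0
  ≡⟨ +-identityʳ _ ⟩
    ∑< c f
  ∎

∑-update : ∀ n a (f g : ℕ → ℕ) → a < n → (∀ v → ¬ v ≡ a → f v ≡ g v) → ∑< n f + g a ≡ ∑< n g + f a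
∑-update (suc n) zero f g _ agree = begin
    f 0 + ∑< n (f ∘ suc) + g 0
  ≡⟨ cong (λ x → f 0 + x + g 0) (∑-cong n (λ m _ → agree (suc m) λ ())) ⟩
    f 0 + ∑< n (g ∘ suc) + g 0
  ≡⟨ swap (f 0) (g 0) _ ⟩
    g 0 + ∑< n (g ∘ suc) + f 0
  ∎
  where
  swap : ∀ x y s → x + s + y ≡ y + s + x
  swap = solve-∀
∑-update (suc n) (suc a) f g (s≤s a<n) agree = begin
    f 0 + ∑< n (f ∘ suc) + g (suc a)
  ≡⟨ +-assoc (f 0) _ _ ⟩
    f 0 + (∑< n (f ∘ suc) + g (suc a))
  ≡⟨ cong₂ _+_ (agree 0 λ ())
               (∑-update n a (f ∘ suc) (g ∘ suc) a<n (λ v v≢a → agree (suc v) (v≢a ∘ suc-injective))) ⟩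
    g 0 + (∑< n (g ∘ suc) + f (suc a))
  ≡⟨ sym (+-assoc (g 0) _ _) ⟩
    g 0 + ∑< n (g ∘ suc) + f (suc a)
  ∎

sum-map-applyUpTo : ∀ (f g : ℕ → ℕ) n → sum (map f (applyUpTo g n)) ≡ ∑< n (f ∘ g)
sum-map-applyUpTo f g zero    = refl
sum-map-applyUpTo f g (suc n) = cong (f (g 0) +_) (sum-map-applyUpTo f (g ∘ suc) n)

sum-map-cong : ∀ {A : Set} {f g : A → ℕ} (xs : List A) → (∀ x → f x ≡ g x) → sum (map f xs) ≡ sum (map g xs)
sum-map-cong xs e = cong sum (map-cong e xs)

sum-map-zero : ∀ {A : Set} {f : A → ℕ} (xs : List A) → (∀ x → f x ≡ 0) → sum (map f xs) ≡ 0
sum-map-zero []       e = refl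
sum-map-zero (x ∷ xs) e = cong₂ _+_ (e x) (sum-map-zero xs e)

sum-map-++ : ∀ {A : Set} (f : A → ℕ) xs ys → sum (map f (xs ++ ys)) ≡ sum (map f xs) + sum (map f ys)
sum-map-++ f xs ys = trans (cong sum (map-++ f xs ys)) (sum-++ (map f xs) (map f ys))

sum-map-map : ∀ {A B : Set} (f : B → ℕ) (g : A → B) xs → sum (map f (map g xs)) ≡ sum (map (f ∘ g) xs)
sum-map-map f g xs = cong sum (sym (map-∘ xs))

sum-map-concatMap : ∀ {A B : Set} (f : B → ℕ) (g : A → List B) xs →
  sum (map f (concatMap g xs)) ≡ sum (map (λ x → sum (map f (g x))) xs)
sum-map-concatMap f g []       = refl
sum-map-concatMap f g (x ∷ xs) =
  trans (sum-map-++ f (g x) (concatMap g xs)) (cong (sum (map f (g x)) +_) (sum-map-concatMap f g xs))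

sum-map-concatMap-upTo : ∀ (f : List ℕ → ℕ) (L : ℕ → List (List ℕ)) n →
  sum (map f (concatMap (λ a → map (a ∷_) (L a)) (upTo n))) ≡ ∑< n (λ a → sum (map (f ∘ (a ∷_)) (L a)))
sum-map-concatMap-upTo f L n = begin
    sum (map f (concatMap (λ a → map (a ∷_) (L a)) (upTo n)))
  ≡⟨ sum-map-concatMap f (λ a → map (a ∷_) (L a)) (upTo n) ⟩
    sum (map (λ a → sum (map f (map (a ∷_) (L a)))) (upTo n))
  ≡⟨ sum-map-applyUpTo (λ a → sum (map f (map (a ∷_) (L a)))) id n ⟩
    ∑< n (λ a → sum (map f (map (a ∷_) (L a))))
  ≡⟨ ∑-cong n (λ a _ → sum-map-map f (a ∷_) (L a)) ⟩
    ∑< n (λ a → sum (map (f ∘ (a ∷_)) (L a)))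
  ∎

sum-map-filter : ∀ {A : Set} {P : A → Set} (P? : ∀ x → Dec (P x)) (f : A → ℕ) xs →
  sum (map f (filter P? xs)) ≡ sum (map (λ x → χ (P? x) * f x) xs)
sum-map-filter P? f []       = refl
sum-map-filter P? f (x ∷ xs) with does (P? x)
... | true  = cong₂ _+_ (sym (+-identityʳ (f x))) (sum-map-filter P? f xs)
... | false = sum-map-filter P? f xs

length-filter≡sum : ∀ {A : Set} {P : A → Set} (P? : ∀ x → Dec (P x)) xs →
  length (filter P? xs) ≡ sum (map (χ ∘ P?) xs)
length-filter≡sum P? []       = refl
length-filter≡sum P? (x ∷ xs) with does (P? x)
... | true  = cong suc (length-filter≡sum P? xs)
... | false = length-filter≡sum P? xs

binomialTransform : (ℕ → ℕ) → ℕ → ℕ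
binomialTransform f n = ∑< (suc n) (λ m → (n C m) * f m)

binomialTransform-cong : ∀ n {f g : ℕ → ℕ} → (∀ m → f m ≡ g m) → binomialTransform f n ≡ binomialTransform g n
binomialTransform-cong n {f} e = ∑-cong (suc n) (λ m _ → cong ((n C m) *_) (e m))

binomialTransform-+ : ∀ n (f g : ℕ → ℕ) →
  binomialTransform (λ m → f m + g m) n ≡ binomialTransform f n + binomialTransform g n
binomialTransform-+ n f g =
  trans (∑-cong (suc n) (λ m _ → *-distribˡ-+ (n C m) (f m) (g m)))
        (∑-+ (suc n) (λ m → (n C m) * f m) (λ m → (n C m) * g m))

binomialTransform-*ˡ : ∀ n c (f : ℕ → ℕ) → binomialTransform (λ m → c * f m) n ≡ c * binomialTransform f n
binomialTransform-*ˡ n c f = begin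
    ∑< (suc n) (λ m → (n C m) * (c * f m))
  ≡⟨ ∑-cong (suc n) (λ m _ → rearrange (n C m) c (f m)) ⟩
    ∑< (suc n) (λ m → (n C m) * f m * c)
  ≡⟨ ∑-*ʳ (suc n) c (λ m → (n C m) * f m) ⟩
    binomialTransform f n * c
  ≡⟨ *-comm _ c ⟩
    c * binomialTransform f n
  ∎
  where
  rearrange : ∀ x c y → x * (c * y) ≡ x * y * c
  rearrange = solve-∀

binomialTransform-suc : ∀ n (f : ℕ → ℕ) →
  binomialTransform f (suc n) ≡ binomialTransform f n + binomialTransform (f ∘ suc) n
binomialTransform-suc n f = begin
    1 * f 0 + ∑< (suc n) (λ m → (suc n C suc m) * f (suc m))
  ≡⟨ cong (1 * f 0 +_) (∑-cong (suc n) (λ m _ → pascal m)) ⟩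
    1 * f 0 + ∑< (suc n) (λ m → (n C m) * f (suc m) + (n C suc m) * f (suc m))
  ≡⟨ cong (1 * f 0 +_) (∑-+ (suc n) (λ m → (n C m) * f (suc m)) (λ m → (n C suc m) * f (suc m))) ⟩
    1 * f 0 + (binomialTransform (f ∘ suc) n + ∑< (suc n) (λ m → (n C suc m) * f (suc m)))
  ≡⟨ cong (λ x → 1 * f 0 + (binomialTransform (f ∘ suc) n + x)) (∑-∷ʳ n (λ m → (n C suc m) * f (suc m))) ⟩
    1 * f 0 + (binomialTransform (f ∘ suc) n + (∑< n (λ m → (n C suc m) * f (suc m)) + (n C suc n) * f (suc n)))
  ≡⟨ cong (λ x → 1 * f 0 + (binomialTransform (f ∘ suc) n + (∑< n (λ m → (n C suc m) * f (suc m)) + x * f (suc n))))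
          (k>n⇒nCk≡0 (n<1+n n)) ⟩
    1 * f 0 + (binomialTransform (f ∘ suc) n + (∑< n (λ m → (n C suc m) * f (suc m)) + 0))
  ≡⟨ regroup (1 * f 0) _ _ ⟩
    (1 * f 0 + ∑< n (λ m → (n C suc m) * f (suc m))) + binomialTransform (f ∘ suc) n
  ∎
  where
  pascal : ∀ m → (suc n C suc m) * f (suc m) ≡ (n C m) * f (suc m) + (n C suc m) * f (suc m)
  pascal m = trans (cong (_* f (suc m)) (sym (nCk+nC[k+1]≡[n+1]C[k+1] n m))) (*-distribʳ-+ (f (suc m)) (n C m) _)
  regroup : ∀ x t s → x + (t + (s + 0)) ≡ (x + s) + t
  regroup = solve-∀

-- Ways to add r elements to a partition with a blocks such that exactly h of them join an
-- existing block.
stirlingFrom : ℕ → ℕ → ℕ → ℕ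
stirlingFrom a zero    zero    = 1
stirlingFrom a zero    (suc h) = 0
stirlingFrom a (suc r) zero    = stirlingFrom (suc a) r zero
stirlingFrom a (suc r) (suc h) = a * stirlingFrom a r h + stirlingFrom (suc a) r (suc h)

-- Ways to add m elements to a partition with b big and u singleton blocks such that exactly h of
-- them do not turn a singleton into a big block (so that b + m - h big blocks result).
bigBlocksFrom : ℕ → ℕ → ℕ → ℕ → ℕ
bigBlocksFrom b u zero    zero    = 1
bigBlocksFrom b u zero    (suc h) = 0
bigBlocksFrom b u (suc m) zero    = u * bigBlocksFrom (suc b) (pred u) m zero
bigBlocksFrom b u (suc m) (suc h) =
  u * bigBlocksFrom (suc b) (pred u) m (suc h) + b * bigBlocksFrom b u m h + bigBlocksFrom b (suc u) m h

bigBlocksFrom-vanishes : ∀ b u m h → m < h → bigBlocksFrom b u m h ≡ 0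
bigBlocksFrom-vanishes b u zero    (suc h) _         = refl
bigBlocksFrom-vanishes b u (suc m) (suc h) (s≤s m<h) = begin
    u * bigBlocksFrom (suc b) (pred u) m (suc h) + b * bigBlocksFrom b u m h + bigBlocksFrom b (suc u) m h
  ≡⟨ cong₂ _+_ (cong₂ _+_ (cong (u *_) (bigBlocksFrom-vanishes (suc b) (pred u) m (suc h) (m<n⇒m<1+n m<h)))
                          (cong (b *_) (bigBlocksFrom-vanishes b u m h m<h)))
               (bigBlocksFrom-vanishes b (suc u) m h m<h) ⟩
    u * 0 + b * 0 + 0
  ≡⟨ cong₂ (λ x y → x + y + 0) (*-zeroʳ u) (*-zeroʳ b) ⟩
    0
  ∎

bigBlocksFrom-no-defect : ∀ b b′ u m → bigBlocksFrom b u m 0 ≡ bigBlocksFrom b′ u m 0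
bigBlocksFrom-no-defect b b′ u zero    = refl
bigBlocksFrom-no-defect b b′ u (suc m) = cong (u *_) (bigBlocksFrom-no-defect (suc b) (suc b′) (pred u) m)

-- Split by the fate of the extra singleton: it stays a singleton to the end, or it is joined at
-- some step and is a big block from then on; the extra big block on the right also counts the
-- runs in which nobody joins it.
bigBlocksFrom-exchange : ∀ b u m h →
  bigBlocksFrom b (suc u) m h + bigBlocksFrom b u m (suc h) ≡ bigBlocksFrom b u m h + bigBlocksFrom (suc b) u m (suc h)
bigBlocksFrom-exchange b u zero    zero    = refl
bigBlocksFrom-exchange b u zero    (suc h) = refl
bigBlocksFrom-exchange b u (suc m) zero    = begin
    suc u * Z + (u * X + b * Z′ + W)
  ≡⟨ cong₂ (λ z w → suc u * Z + (u * X + b * z + w))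
           (bigBlocksFrom-no-defect b (suc b) u m) (bigBlocksFrom-no-defect b (suc b) (suc u) m) ⟩
    suc u * Z + (u * X + b * Z + W′)
  ≡⟨ regroup u b Z X W′ ⟩
    u * (Z + X) + (suc b * Z + W′)
  ≡⟨ cong (_+ (suc b * Z + W′)) (*-congˡ-nonzero u λ { refl → bigBlocksFrom-exchange (suc b) (pred u) m zero }) ⟩
    u * (A + B) + (suc b * Z + W′)
  ≡⟨ regroup′ u b A B Z W′ ⟩
    u * A + (u * B + suc b * Z + W′)
  ∎
  where
  Z = bigBlocksFrom (suc b) u m 0
  Z′ = bigBlocksFrom b u m 0
  X = bigBlocksFrom (suc b) (pred u) m 1
  W = bigBlocksFrom b (suc u) m 0
  W′ = bigBlocksFrom (suc b) (suc u) m 0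
  A = bigBlocksFrom (suc b) (pred u) m 0
  B = bigBlocksFrom (suc (suc b)) (pred u) m 1
  regroup : ∀ u b Z X W → suc u * Z + (u * X + b * Z + W) ≡ u * (Z + X) + (suc b * Z + W)
  regroup = solve-∀
  regroup′ : ∀ u b A B Z W → u * (A + B) + (suc b * Z + W) ≡ u * A + (u * B + suc b * Z + W)
  regroup′ = solve-∀
bigBlocksFrom-exchange b u (suc m) (suc h) = begin
    (suc u * P + b * Q + R) + (u * X + b * Y + T)
  ≡⟨ regroup u b P Q R X Y T ⟩
    P + u * (P + X) + (b * (Q + Y) + (R + T))
  ≡⟨ cong₂ (λ x y → P + x + y)
       (*-congˡ-nonzero u λ { refl → bigBlocksFrom-exchange (suc b) (pred u) m (suc h) })
       (cong₂ (λ x y → b * x + y) (bigBlocksFrom-exchange b u m h) (bigBlocksFrom-exchange b (suc u) m h)) ⟩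
    P + u * (A + D) + (b * (B + P) + (Q + E))
  ≡⟨ regroup′ u b P Q A B D E ⟩
    (u * A + b * B + Q) + (u * D + suc b * P + E)
  ∎
  where
  P = bigBlocksFrom (suc b) u m (suc h)
  Q = bigBlocksFrom b (suc u) m h
  R = bigBlocksFrom b (suc (suc u)) m h
  X = bigBlocksFrom (suc b) (pred u) m (suc (suc h))
  Y = bigBlocksFrom b u m (suc h)
  T = bigBlocksFrom b (suc u) m (suc h)
  A = bigBlocksFrom (suc b) (pred u) m (suc h)
  B = bigBlocksFrom b u m h
  D = bigBlocksFrom (suc (suc b)) (pred u) m (suc (suc h))
  E = bigBlocksFrom (suc b) (suc u) m (suc h)
  regroup : ∀ u b P Q R X Y T →
    (suc u * P + b * Q + R) + (u * X + b * Y + T) ≡ P + u * (P + X) + (b * (Q + Y) + (R + T))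
  regroup = solve-∀
  regroup′ : ∀ u b P Q A B D E →
    P + u * (A + D) + (b * (B + P) + (Q + E)) ≡ (u * A + b * B + Q) + (u * D + suc b * P + E)
  regroup′ = solve-∀

binomialTransform-bigBlocksFrom-exchange : ∀ b u n h →
  binomialTransform (λ m → bigBlocksFrom b (suc u) m h) n + binomialTransform (λ m → bigBlocksFrom b u m (suc h)) n ≡
  binomialTransform (λ m → bigBlocksFrom b u m h) n + binomialTransform (λ m → bigBlocksFrom (suc b) u m (suc h)) n
binomialTransform-bigBlocksFrom-exchange b u n h = begin
    binomialTransform (λ m → bigBlocksFrom b (suc u) m h) n + binomialTransform (λ m → bigBlocksFrom b u m (suc h)) n
  ≡⟨ sym (binomialTransform-+ n (λ m → bigBlocksFrom b (suc u) m h) (λ m → bigBlocksFrom b u m (suc h))) ⟩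
    binomialTransform (λ m → bigBlocksFrom b (suc u) m h + bigBlocksFrom b u m (suc h)) n
  ≡⟨ binomialTransform-cong n (λ m → bigBlocksFrom-exchange b u m h) ⟩
    binomialTransform (λ m → bigBlocksFrom b u m h + bigBlocksFrom (suc b) u m (suc h)) n
  ≡⟨ binomialTransform-+ n (λ m → bigBlocksFrom b u m h) (λ m → bigBlocksFrom (suc b) u m (suc h)) ⟩
    binomialTransform (λ m → bigBlocksFrom b u m h) n + binomialTransform (λ m → bigBlocksFrom (suc b) u m (suc h)) n
  ∎

binomialTransform-bigBlocksFrom : ∀ b n h →
  binomialTransform (λ m → bigBlocksFrom b 0 m h) n ≡ stirlingFrom (suc b) n h
binomialTransform-bigBlocksFrom b zero    zero    = refl
binomialTransform-bigBlocksFrom b zero    (suc h) = refl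
binomialTransform-bigBlocksFrom b (suc n) zero    = begin
    binomialTransform (λ m → bigBlocksFrom b 0 m 0) (suc n)
  ≡⟨ binomialTransform-suc n (λ m → bigBlocksFrom b 0 m 0) ⟩
    binomialTransform (λ m → bigBlocksFrom b 0 m 0) n + binomialTransform (λ _ → 0) n
  ≡⟨ cong₂ _+_ (binomialTransform-cong n (λ m → bigBlocksFrom-no-defect b (suc b) 0 m))
               (∑-zero (suc n) (λ m _ → *-zeroʳ (n C m))) ⟩
    binomialTransform (λ m → bigBlocksFrom (suc b) 0 m 0) n + 0
  ≡⟨ trans (+-identityʳ _) (binomialTransform-bigBlocksFrom (suc b) n zero) ⟩
    stirlingFrom (suc (suc b)) n zero
  ∎
binomialTransform-bigBlocksFrom b (suc n) (suc h) = begin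
    binomialTransform (λ m → bigBlocksFrom b 0 m (suc h)) (suc n)
  ≡⟨ binomialTransform-suc n (λ m → bigBlocksFrom b 0 m (suc h)) ⟩
    Y′ + binomialTransform (λ m → b * bigBlocksFrom b 0 m h + bigBlocksFrom b 1 m h) n
  ≡⟨ cong (Y′ +_) (trans (binomialTransform-+ n (λ m → b * bigBlocksFrom b 0 m h) (λ m → bigBlocksFrom b 1 m h))
                         (cong (_+ W) (binomialTransform-*ˡ n b (λ m → bigBlocksFrom b 0 m h)))) ⟩
    Y′ + (b * Y + W)
  ≡⟨ regroup Y′ (b * Y) W ⟩
    b * Y + (W + Y′)
  ≡⟨ cong (b * Y +_) (binomialTransform-bigBlocksFrom-exchange b 0 n h) ⟩
    b * Y + (Y + V)
  ≡⟨ regroup′ b Y V ⟩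
    suc b * Y + V
  ≡⟨ cong₂ (λ x y → suc b * x + y)
           (binomialTransform-bigBlocksFrom b n h) (binomialTransform-bigBlocksFrom (suc b) n (suc h)) ⟩
    stirlingFrom (suc b) (suc n) (suc h)
  ∎
  where
  Y = binomialTransform (λ m → bigBlocksFrom b 0 m h) n
  Y′ = binomialTransform (λ m → bigBlocksFrom b 0 m (suc h)) n
  W = binomialTransform (λ m → bigBlocksFrom b 1 m h) n
  V = binomialTransform (λ m → bigBlocksFrom (suc b) 0 m (suc h)) n
  regroup : ∀ x y z → x + (y + z) ≡ y + (z + x)
  regroup = solve-∀
  regroup′ : ∀ b y v → b * y + (y + v) ≡ suc b * y + v
  regroup′ = solve-∀

-- Ways to add r elements to a partition with b big and u singleton blocks, each result weighted
-- by g (number of blocks) (number of big blocks).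
extensions : (ℕ → ℕ → ℕ) → ℕ → ℕ → ℕ → ℕ
extensions g b u zero    = g (b + u) b
extensions g b u (suc r) = u * extensions g (suc b) (pred u) r + b * extensions g b u r + extensions g b (suc u) r

extensions-unreachable : ∀ g b u r → (∀ c d → c ≤ b + u + r → d ≤ b + r → g c d ≡ 0) → extensions g b u r ≡ 0
extensions-unreachable g b u zero    vanish =
  vanish (b + u) b (≤-reflexive (sym (+-identityʳ (b + u)))) (≤-reflexive (sym (+-identityʳ b)))
extensions-unreachable g b u (suc r) vanish = begin
    u * extensions g (suc b) (pred u) r + b * extensions g b u r + extensions g b (suc u) r
  ≡⟨ cong₂ _+_ (cong₂ _+_ (cong (u *_) joinSingleton) (cong (b *_) joinBig)) openBlock ⟩
    u * 0 + b * 0 + 0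
  ≡⟨ cong₂ (λ x y → x + y + 0) (*-zeroʳ u) (*-zeroʳ b) ⟩
    0
  ∎
  where
  vanish′ : ∀ c d → c ≤ suc (b + u + r) → d ≤ suc (b + r) → g c d ≡ 0
  vanish′ c d c≤ d≤ = vanish c d (subst (c ≤_) (sym (+-suc (b + u) r)) c≤) (subst (d ≤_) (sym (+-suc b r)) d≤)
  joinSingleton : extensions g (suc b) (pred u) r ≡ 0
  joinSingleton = extensions-unreachable g (suc b) (pred u) r λ c d c≤ d≤ →
    vanish′ c d (≤-trans c≤ (s≤s (+-monoˡ-≤ r (+-monoʳ-≤ b pred[n]≤n)))) d≤
  joinBig : extensions g b u r ≡ 0
  joinBig = extensions-unreachable g b u r λ c d c≤ d≤ → vanish′ c d (m≤n⇒m≤1+n c≤) (m≤n⇒m≤1+n d≤)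
  openBlock : extensions g b (suc u) r ≡ 0
  openBlock = extensions-unreachable g b (suc u) r λ c d c≤ d≤ →
    vanish′ c d (subst (c ≤_) (cong (_+ r) (+-suc b u)) c≤) (m≤n⇒m≤1+n d≤)

extensions-stirlingFrom : ∀ k a h b u r → b + u ≡ a → k + h ≡ a + r →
  extensions (λ c _ → χ (c ≟ k)) b u r ≡ stirlingFrom a r h
extensions-stirlingFrom k a zero    b u zero    refl e = χ-yes (b + u ≟ k) (sym (+-cancelʳ-≡ 0 k (b + u) e))
extensions-stirlingFrom k a (suc h) b u zero    refl e =
  χ-no (b + u ≟ k) λ a≡k → m+1+n≢m k (trans e (trans (+-identityʳ _) a≡k))
extensions-stirlingFrom k a zero    b u (suc r) b+u≡a e = begin
    u * extensions g (suc b) (pred u) r + b * extensions g b u r + extensions g b (suc u) r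
  ≡⟨ cong₂ (λ x y → x + y + extensions g b (suc u) r)
       (trans (*-congˡ-nonzero u λ { refl → unreachable (suc b) _ (sym (+-suc b _)) }) (*-zeroʳ u))
       (trans (cong (b *_) (unreachable b u refl)) (*-zeroʳ b)) ⟩
    extensions g b (suc u) r
  ≡⟨ extensions-stirlingFrom k (suc a) zero b (suc u) r (trans (+-suc b u) (cong suc b+u≡a)) (trans e (+-suc a r)) ⟩
    stirlingFrom (suc a) r zero
  ∎
  where
  g : ℕ → ℕ → ℕ
  g c _ = χ (c ≟ k)
  k≡1+a+r : k ≡ suc (a + r)
  k≡1+a+r = trans (sym (+-identityʳ k)) (trans e (+-suc a r))
  unreachable : ∀ b′ u′ → b′ + u′ ≡ b + u → extensions g b′ u′ r ≡ 0
  unreachable b′ u′ same = extensions-unreachable g b′ u′ r λ c _ c≤ _ →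
    χ-no (c ≟ k) λ c≡k →
      1+n≰n (subst (_≤ a + r) (trans c≡k k≡1+a+r) (≤-trans c≤ (≤-reflexive (cong (_+ r) (trans same b+u≡a)))))
extensions-stirlingFrom k a (suc h) b u (suc r) b+u≡a e = begin
    u * extensions g (suc b) (pred u) r + b * extensions g b u r + extensions g b (suc u) r
  ≡⟨ cong₂ _+_
       (cong₂ _+_ (*-congˡ-nonzero u λ { refl →
                    extensions-stirlingFrom k a h (suc b) _ r (trans (sym (+-suc b _)) b+u≡a) e′ })
                  (cong (b *_) (extensions-stirlingFrom k a h b u r b+u≡a e′)))
       (extensions-stirlingFrom k (suc a) (suc h) b (suc u) r (trans (+-suc b u) (cong suc b+u≡a)) (trans e (+-suc a r))) ⟩
    u * stirlingFrom a r h + b * stirlingFrom a r h + stirlingFrom (suc a) r (suc h)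
  ≡⟨ cong (_+ stirlingFrom (suc a) r (suc h))
          (trans (sym (*-distribʳ-+ (stirlingFrom a r h) u b)) (cong (_* stirlingFrom a r h) (trans (+-comm u b) b+u≡a))) ⟩
    a * stirlingFrom a r h + stirlingFrom (suc a) r (suc h)
  ∎
  where
  g : ℕ → ℕ → ℕ
  g c _ = χ (c ≟ k)
  e′ : k + h ≡ a + r
  e′ = suc-injective (trans (sym (+-suc k h)) (trans e (+-suc a r)))

extensions-bigBlocksFrom : ∀ j h b u m → j + h ≡ b + m →
  extensions (λ _ d → χ (d ≟ j)) b u m ≡ bigBlocksFrom b u m h
extensions-bigBlocksFrom j zero    b u zero    e = χ-yes (b ≟ j) (sym (+-cancelʳ-≡ 0 j b e))
extensions-bigBlocksFrom j (suc h) b u zero    e =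
  χ-no (b ≟ j) λ b≡j → m+1+n≢m j (trans e (trans (+-identityʳ b) b≡j))
extensions-bigBlocksFrom j zero    b u (suc m) e = begin
    u * extensions g (suc b) (pred u) m + b * extensions g b u m + extensions g b (suc u) m
  ≡⟨ cong₂ (λ x y → u * x + b * y + extensions g b (suc u) m)
           (extensions-bigBlocksFrom j zero (suc b) (pred u) m (trans e (+-suc b m))) (unreachable u) ⟩
    u * bigBlocksFrom (suc b) (pred u) m zero + b * 0 + extensions g b (suc u) m
  ≡⟨ cong₂ (λ x y → u * bigBlocksFrom (suc b) (pred u) m zero + x + y) (*-zeroʳ b) (unreachable (suc u)) ⟩
    u * bigBlocksFrom (suc b) (pred u) m zero + 0 + 0
  ≡⟨ trans (+-identityʳ _) (+-identityʳ _) ⟩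
    u * bigBlocksFrom (suc b) (pred u) m zero
  ∎
  where
  g : ℕ → ℕ → ℕ
  g _ d = χ (d ≟ j)
  unreachable : ∀ u′ → extensions g b u′ m ≡ 0
  unreachable u′ = extensions-unreachable g b u′ m λ _ d _ d≤ →
    χ-no (d ≟ j) λ d≡j → 1+n≰n (subst (_≤ b + m) (trans d≡j (trans (sym (+-identityʳ j)) (trans e (+-suc b m)))) d≤)
extensions-bigBlocksFrom j (suc h) b u (suc m) e =
  cong₂ _+_ (cong₂ _+_ (cong (u *_) (extensions-bigBlocksFrom j (suc h) (suc b) (pred u) m (trans e (+-suc b m))))
                       (cong (b *_) (extensions-bigBlocksFrom j h b u m e′)))
            (extensions-bigBlocksFrom j h b (suc u) m e′)
  where
  e′ : j + h ≡ b + m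
  e′ = suc-injective (trans (sym (+-suc j h)) (trans e (+-suc b m)))

canonicalTails : ℕ → ℕ → List (List ℕ)
canonicalTails c zero    = [] ∷ []
canonicalTails c (suc r) =
  concatMap (λ a → map (a ∷_) (canonicalTails c r)) (upTo c) ++ map (c ∷_) (canonicalTails (suc c) r)

sum-map-canonicalTails-suc : ∀ c r (f : List ℕ → ℕ) →
  sum (map f (canonicalTails c (suc r))) ≡
  ∑< c (λ a → sum (map (f ∘ (a ∷_)) (canonicalTails c r))) + sum (map (f ∘ (c ∷_)) (canonicalTails (suc c) r))
sum-map-canonicalTails-suc c r f = begin
    sum (map f (concatMap (λ a → map (a ∷_) (canonicalTails c r)) (upTo c) ++ new))
  ≡⟨ sum-map-++ f (concatMap (λ a → map (a ∷_) (canonicalTails c r)) (upTo c)) new ⟩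
    sum (map f (concatMap (λ a → map (a ∷_) (canonicalTails c r)) (upTo c))) + sum (map f new)
  ≡⟨ cong₂ _+_ (sum-map-concatMap-upTo f (λ _ → canonicalTails c r) c) (sum-map-map f (c ∷_) (canonicalTails (suc c) r)) ⟩
    ∑< c (λ a → sum (map (f ∘ (a ∷_)) (canonicalTails c r))) + sum (map (f ∘ (c ∷_)) (canonicalTails (suc c) r))
  ∎
  where
  new = map (c ∷_) (canonicalTails (suc c) r)

canonicalFrom-old : ∀ {a c} s → a < c → canonicalFrom c (a ∷ s) ≡ canonicalFrom c s
canonicalFrom-old {a} {c} s a<c with a <? c
... | yes _   = refl
... | no  a≮c = ⊥-elim (a≮c a<c)

canonicalFrom-new : ∀ c s → canonicalFrom c (c ∷ s) ≡ canonicalFrom (suc c) s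
canonicalFrom-new c s with c <? c
... | yes c<c = ⊥-elim (<-irrefl refl c<c)
... | no  _ with c ≟ c
...   | yes _   = refl
...   | no  c≢c = ⊥-elim (c≢c refl)

canonicalFrom-gap : ∀ {a c} s → c < a → canonicalFrom c (a ∷ s) ≡ false
canonicalFrom-gap {a} {c} s c<a with a <? c
... | yes a<c = ⊥-elim (<-asym c<a a<c)
... | no  _ with a ≟ c
...   | yes a≡c = ⊥-elim (<-irrefl (sym a≡c) c<a)
...   | no  _   = refl

sum-map-canonical-labellings : ∀ r c b (f : List ℕ → ℕ) → c + r ≤ b →
  sum (map (λ s → χ (canonicalFrom c s ≟ᵇ true) * f s) (labellings b r)) ≡ sum (map f (canonicalTails c r))
sum-map-canonical-labellings zero    c b f _   = cong (_+ 0) (+-identityʳ (f []))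
sum-map-canonical-labellings (suc r) c b f c+r≤b = begin
    sum (map F (concatMap (λ a → map (a ∷_) (labellings b r)) (upTo b)))
  ≡⟨ sum-map-concatMap-upTo F (λ _ → labellings b r) b ⟩
    ∑< b ψ
  ≡⟨ ∑-drop-tail (suc c) b ψ c<b gap ⟩
    ∑< (suc c) ψ
  ≡⟨ ∑-∷ʳ c ψ ⟩
    ∑< c ψ + ψ c
  ≡⟨ cong₂ _+_ (∑-cong c old) new ⟩
    ∑< c (λ a → sum (map (f ∘ (a ∷_)) (canonicalTails c r))) + sum (map (f ∘ (c ∷_)) (canonicalTails (suc c) r))
  ≡⟨ sym (sum-map-canonicalTails-suc c r f) ⟩
    sum (map f (canonicalTails c (suc r)))
  ∎
  where
  F : List ℕ → ℕ
  F s = χ (canonicalFrom c s ≟ᵇ true) * f s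
  ψ : ℕ → ℕ
  ψ a = sum (map (F ∘ (a ∷_)) (labellings b r))
  c<b : c < b
  c<b = ≤-trans (subst (_≤ c + suc r) (+-comm c 1) (+-monoʳ-≤ c (s≤s z≤n))) c+r≤b
  canonicalFrom-cong : ∀ {a} (B : List ℕ → Bool) → (∀ s → canonicalFrom c (a ∷ s) ≡ B s) →
    ψ a ≡ sum (map (λ s → χ (B s ≟ᵇ true) * f (a ∷ s)) (labellings b r))
  canonicalFrom-cong {a} _ e = sum-map-cong (labellings b r) (λ s → cong (λ z → χ (z ≟ᵇ true) * f (a ∷ s)) (e s))
  gap : ∀ a → suc c ≤ a → ψ a ≡ 0
  gap a c<a = trans (canonicalFrom-cong (λ _ → false) (λ s → canonicalFrom-gap s c<a))
                    (sum-map-zero (labellings b r) (λ _ → refl))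
  old : ∀ a → a < c → ψ a ≡ sum (map (f ∘ (a ∷_)) (canonicalTails c r))
  old a a<c = trans (canonicalFrom-cong (canonicalFrom c) (λ s → canonicalFrom-old s a<c))
                    (sum-map-canonical-labellings r c b (f ∘ (a ∷_)) (≤-trans (+-monoʳ-≤ c (n≤1+n r)) c+r≤b))
  new : ψ c ≡ sum (map (f ∘ (c ∷_)) (canonicalTails (suc c) r))
  new = trans (canonicalFrom-cong (canonicalFrom (suc c)) (canonicalFrom-new c))
              (sum-map-canonical-labellings r (suc c) b (f ∘ (c ∷_)) (subst (_≤ b) (+-suc c r) c+r≤b))

sum-map-partitions : ∀ n (f : List ℕ → ℕ) → sum (map f (partitions n)) ≡ sum (map f (canonicalTails 0 n))
sum-map-partitions n f =
  trans (sum-map-filter (λ s → canonicalFrom 0 s ≟ᵇ true) f (labellings n n)) (sum-map-canonical-labellings n 0 n f ≤-refl)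

blockSize-∷ʳ : ∀ s a v → blockSize (s ++ [ a ]) v ≡ blockSize s v + χ (a ≟ v)
blockSize-∷ʳ s a v = begin
    length (filter (_≟ v) (s ++ [ a ]))
  ≡⟨ length-filter≡sum (_≟ v) (s ++ [ a ]) ⟩
    sum (map (χ ∘ (_≟ v)) (s ++ [ a ]))
  ≡⟨ sum-map-++ (χ ∘ (_≟ v)) s [ a ] ⟩
    sum (map (χ ∘ (_≟ v)) s) + (χ (a ≟ v) + 0)
  ≡⟨ cong₂ _+_ (sym (length-filter≡sum (_≟ v) s)) (+-identityʳ _) ⟩
    blockSize s v + χ (a ≟ v)
  ∎

blockSize-∷ʳ-other : ∀ s {a v} → ¬ a ≡ v → blockSize (s ++ [ a ]) v ≡ blockSize s v
blockSize-∷ʳ-other s {a} {v} a≢v =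
  trans (blockSize-∷ʳ s a v) (trans (cong (blockSize s v +_) (χ-no (a ≟ v) a≢v)) (+-identityʳ _))

blockSize-∷ʳ-same : ∀ s a → blockSize (s ++ [ a ]) a ≡ suc (blockSize s a)
blockSize-∷ʳ-same s a =
  trans (blockSize-∷ʳ s a a) (trans (cong (blockSize s a +_) (χ-yes (a ≟ a) refl)) (+-comm _ 1))

record UsesLabelsBelow (c : ℕ) (s : List ℕ) : Set where
  field
    unused   : ∀ v → c ≤ v → blockSize s v ≡ 0
    used     : ∀ v → v < c → 1 ≤ blockSize s v
    c≤length : c ≤ length s
open UsesLabelsBelow

usesLabelsBelow-[] : UsesLabelsBelow 0 []
usesLabelsBelow-[] = record { unused = λ _ _ → refl ; used = λ _ () ; c≤length = z≤n }

usesLabelsBelow-old : ∀ {c s a} → a < c → UsesLabelsBelow c s → UsesLabelsBelow c (s ++ [ a ])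
usesLabelsBelow-old {c} {s} {a} a<c L = record
  { unused   = λ v c≤v → trans (blockSize-∷ʳ-other s (λ a≡v → <-irrefl a≡v (<-≤-trans a<c c≤v))) (unused L v c≤v)
  ; used     = λ v v<c → ≤-trans (used L v v<c) (≤-trans (m≤m+n _ _) (≤-reflexive (sym (blockSize-∷ʳ s a v))))
  ; c≤length = ≤-trans (c≤length L) (length-++-≤ˡ s)
  }

usesLabelsBelow-new : ∀ {c s} → UsesLabelsBelow c s → UsesLabelsBelow (suc c) (s ++ [ c ])
usesLabelsBelow-new {c} {s} L = record
  { unused   = λ v c<v → trans (blockSize-∷ʳ-other s (λ c≡v → <-irrefl c≡v c<v)) (unused L v (<⇒≤ c<v))
  ; used     = used′
  ; c≤length = subst (suc c ≤_) (trans (+-comm 1 (length s)) (sym (length-++ s))) (s≤s (c≤length L))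
  }
  where
  used′ : ∀ v → v < suc c → 1 ≤ blockSize (s ++ [ c ]) v
  used′ v (s≤s v≤c) with v ≟ c
  ... | yes refl = subst (1 ≤_) (sym (blockSize-∷ʳ-same s c)) (s≤s z≤n)
  ... | no  v≢c  = subst (1 ≤_) (sym (blockSize-∷ʳ-other s (v≢c ∘ sym))) (used L v (≤∧≢⇒< v≤c v≢c))

singletonBlocks : List ℕ → ℕ → ℕ
singletonBlocks s c = ∑< c (λ v → χ (blockSize s v ≟ 1))

bigBlocks : List ℕ → ℕ → ℕ
bigBlocks s c = ∑< c (λ v → χ (2 ≤? blockSize s v))

length-filter-upTo : ∀ {P : ℕ → Set} (P? : ∀ v → Dec (P v)) n → length (filter P? (upTo n)) ≡ ∑< n (χ ∘ P?)
length-filter-upTo P? n = trans (length-filter≡sum P? (upTo n)) (sum-map-applyUpTo (χ ∘ P?) id n)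

numBlocks-usesLabelsBelow : ∀ {c s} → UsesLabelsBelow c s → numBlocks s ≡ c
numBlocks-usesLabelsBelow {c} {s} L = begin
    length (filter (λ v → 1 ≤? blockSize s v) (upTo (length s)))
  ≡⟨ length-filter-upTo (λ v → 1 ≤? blockSize s v) (length s) ⟩
    ∑< (length s) (λ v → χ (1 ≤? blockSize s v))
  ≡⟨ ∑-drop-tail c (length s) _ (c≤length L)
       (λ v c≤v → χ-no (1 ≤? blockSize s v) (λ 1≤ → 1+n≰n (subst (1 ≤_) (unused L v c≤v) 1≤))) ⟩
    ∑< c (λ v → χ (1 ≤? blockSize s v))
  ≡⟨ ∑-cong c (λ v v<c → χ-yes (1 ≤? blockSize s v) (used L v v<c)) ⟩
    ∑< c (λ _ → 1)
  ≡⟨ trans (∑-const c 1) (*-identityʳ c) ⟩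
    c
  ∎

numBigBlocks-usesLabelsBelow : ∀ {c s} → UsesLabelsBelow c s → numBigBlocks s ≡ bigBlocks s c
numBigBlocks-usesLabelsBelow {c} {s} L =
  trans (length-filter-upTo (λ v → 2 ≤? blockSize s v) (length s))
        (∑-drop-tail c (length s) _ (c≤length L)
          (λ v c≤v → χ-no (2 ≤? blockSize s v)
                            (λ 2≤ → 1+n≰n (≤-trans (s≤s z≤n) (subst (2 ≤_) (unused L v c≤v) 2≤)))))

bigBlocks+singletonBlocks : ∀ {c s} → UsesLabelsBelow c s → bigBlocks s c + singletonBlocks s c ≡ c
bigBlocks+singletonBlocks {c} {s} L = begin
    bigBlocks s c + singletonBlocks s c
  ≡⟨ sym (∑-+ c _ _) ⟩
    ∑< c (λ v → χ (2 ≤? blockSize s v) + χ (blockSize s v ≟ 1))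
  ≡⟨ ∑-cong c (λ v v<c → big-or-single (blockSize s v) (used L v v<c)) ⟩
    ∑< c (λ _ → 1)
  ≡⟨ trans (∑-const c 1) (*-identityʳ c) ⟩
    c
  ∎
  where
  big-or-single : ∀ k → 1 ≤ k → χ (2 ≤? k) + χ (k ≟ 1) ≡ 1
  big-or-single (suc zero)    _ = refl
  big-or-single (suc (suc k)) _ = refl

∑-blockSize-old : ∀ (F : ℕ → ℕ) s {c a} → a < c →
  ∑< c (F ∘ blockSize (s ++ [ a ])) + F (blockSize s a) ≡ ∑< c (F ∘ blockSize s) + F (suc (blockSize s a))
∑-blockSize-old F s {c} {a} a<c = begin
    ∑< c (F ∘ blockSize (s ++ [ a ])) + F (blockSize s a)
  ≡⟨ ∑-update c a (F ∘ blockSize (s ++ [ a ])) (F ∘ blockSize s) a<c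
              (λ v v≢a → cong F (blockSize-∷ʳ-other s (v≢a ∘ sym))) ⟩
    ∑< c (F ∘ blockSize s) + F (blockSize (s ++ [ a ]) a)
  ≡⟨ cong (λ k → ∑< c (F ∘ blockSize s) + F k) (blockSize-∷ʳ-same s a) ⟩
    ∑< c (F ∘ blockSize s) + F (suc (blockSize s a))
  ∎

∑-blockSize-new : ∀ (F : ℕ → ℕ) {c s} → UsesLabelsBelow c s →
  ∑< (suc c) (F ∘ blockSize (s ++ [ c ])) ≡ ∑< c (F ∘ blockSize s) + F 1
∑-blockSize-new F {c} {s} L = begin
    ∑< (suc c) (F ∘ blockSize (s ++ [ c ]))
  ≡⟨ ∑-∷ʳ c (F ∘ blockSize (s ++ [ c ])) ⟩
    ∑< c (F ∘ blockSize (s ++ [ c ])) + F (blockSize (s ++ [ c ]) c)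
  ≡⟨ cong₂ _+_ (∑-cong c (λ v v<c → cong F (blockSize-∷ʳ-other s λ c≡v → <-irrefl (sym c≡v) v<c)))
               (cong F (trans (blockSize-∷ʳ-same s c) (cong suc (unused L c ≤-refl)))) ⟩
    ∑< c (F ∘ blockSize s) + F 1
  ∎

extensions-after-join : ∀ g r k {b u b′ u′} → 1 ≤ k →
  u′ + χ (k ≟ 1) ≡ u + χ (suc k ≟ 1) → b′ + χ (2 ≤? k) ≡ b + χ (2 ≤? suc k) →
  extensions g b′ u′ r ≡ χ (k ≟ 1) * extensions g (suc b) (pred u) r + χ (2 ≤? k) * extensions g b u r
extensions-after-join g r (suc zero)    {b} {u} {b′} {u′} _ u′+1≡u b′≡b+1 = begin
    extensions g b′ u′ r
  ≡⟨ cong₂ (λ x y → extensions g x y r) (trans (sym (+-identityʳ b′)) (trans b′≡b+1 (+-comm b 1)))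
                                        (cong pred (trans (+-comm 1 u′) (trans u′+1≡u (+-identityʳ u)))) ⟩
    extensions g (suc b) (pred u) r
  ≡⟨ sym (trans (+-identityʳ _) (+-identityʳ _)) ⟩
    1 * extensions g (suc b) (pred u) r + 0 * extensions g b u r
  ∎
extensions-after-join g r (suc (suc k)) {b} {u} {b′} {u′} _ u′≡u b′+1≡b+1 = begin
    extensions g b′ u′ r
  ≡⟨ cong₂ (λ x y → extensions g x y r) (+-cancelʳ-≡ 1 b′ b b′+1≡b+1) (+-cancelʳ-≡ 0 u′ u u′≡u) ⟩
    extensions g b u r
  ≡⟨ sym (+-identityʳ _) ⟩
    0 * extensions g (suc b) (pred u) r + 1 * extensions g b u r
  ∎

blockWeight : (ℕ → ℕ → ℕ) → List ℕ → ℕ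
blockWeight g s = g (numBlocks s) (numBigBlocks s)

sum-map-blockWeight-canonicalTails : ∀ g r {c s} → UsesLabelsBelow c s →
  sum (map (blockWeight g ∘ (s ++_)) (canonicalTails c r)) ≡ extensions g (bigBlocks s c) (singletonBlocks s c) r
sum-map-blockWeight-canonicalTails g zero {c} {s} L =
  trans (+-identityʳ _)
        (cong₂ g (trans (cong numBlocks (++-identityʳ s)) (trans (numBlocks-usesLabelsBelow L) (sym (bigBlocks+singletonBlocks L))))
                 (trans (cong numBigBlocks (++-identityʳ s)) (numBigBlocks-usesLabelsBelow L)))
sum-map-blockWeight-canonicalTails g (suc r) {c} {s} L = begin
    sum (map (blockWeight g ∘ (s ++_)) (canonicalTails c (suc r)))
  ≡⟨ sum-map-canonicalTails-suc c r (blockWeight g ∘ (s ++_)) ⟩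
    ∑< c (λ a → sum (map (blockWeight g ∘ (s ++_) ∘ (a ∷_)) (canonicalTails c r)))
      + sum (map (blockWeight g ∘ (s ++_) ∘ (c ∷_)) (canonicalTails (suc c) r))
  ≡⟨ cong₂ _+_ (∑-cong c (λ a a<c → trans (appended a) (oldLabel a a<c))) (trans (appended c) newLabel) ⟩
    ∑< c (λ a → χ (blockSize s a ≟ 1) * X + χ (2 ≤? blockSize s a) * Y) + extensions g b (suc u) r
  ≡⟨ cong (_+ extensions g b (suc u) r) (trans (∑-+ c _ _) (cong₂ _+_ (∑-*ʳ c X _) (∑-*ʳ c Y _))) ⟩
    u * X + b * Y + extensions g b (suc u) r
  ∎
  where
  b = bigBlocks s c
  u = singletonBlocks s c
  X = extensions g (suc b) (pred u) r
  Y = extensions g b u r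
  count : List ℕ → ℕ → ℕ
  count s′ d = sum (map (blockWeight g ∘ (s′ ++_)) (canonicalTails d r))
  appended : ∀ a {d} → sum (map (blockWeight g ∘ (s ++_) ∘ (a ∷_)) (canonicalTails d r)) ≡ count (s ++ [ a ]) d
  appended a {d} = sum-map-cong (canonicalTails d r) (λ t → cong (blockWeight g) (sym (++-assoc s [ a ] t)))
  oldLabel : ∀ a → a < c → count (s ++ [ a ]) c ≡ χ (blockSize s a ≟ 1) * X + χ (2 ≤? blockSize s a) * Y
  oldLabel a a<c = trans (sum-map-blockWeight-canonicalTails g r (usesLabelsBelow-old a<c L))
    (extensions-after-join g r (blockSize s a) (used L a a<c)
      (∑-blockSize-old (λ k → χ (k ≟ 1)) s a<c)
      (∑-blockSize-old (λ k → χ (2 ≤? k)) s a<c))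
  newLabel : count (s ++ [ c ]) (suc c) ≡ extensions g b (suc u) r
  newLabel = trans (sum-map-blockWeight-canonicalTails g r (usesLabelsBelow-new L))
    (cong₂ (λ x y → extensions g x y r) (trans (∑-blockSize-new (λ k → χ (2 ≤? k)) L) (+-identityʳ b))
                                        (trans (∑-blockSize-new (λ k → χ (k ≟ 1)) L) (+-comm u 1)))

sum-map-blockWeight-partitions : ∀ g n → sum (map (blockWeight g) (partitions n)) ≡ extensions g 0 0 n
sum-map-blockWeight-partitions g n =
  trans (sum-map-partitions n (blockWeight g)) (sum-map-blockWeight-canonicalTails g n usesLabelsBelow-[])

S-stirlingFrom : ∀ n h → h ≤ suc n → S (suc n) (suc n ∸ h) ≡ stirlingFrom 1 n h
S-stirlingFrom n h h≤1+n = begin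
    S (suc n) k
  ≡⟨ length-filter≡sum (λ s → numBlocks s ≟ k) (partitions (suc n)) ⟩
    sum (map (blockWeight (λ c _ → χ (c ≟ k))) (partitions (suc n)))
  ≡⟨ sum-map-blockWeight-partitions (λ c _ → χ (c ≟ k)) (suc n) ⟩
    extensions (λ c _ → χ (c ≟ k)) 0 1 n
  ≡⟨ extensions-stirlingFrom k 1 h 0 1 n refl (m∸n+n≡m h≤1+n) ⟩
    stirlingFrom 1 n h
  ∎
  where
  k = suc n ∸ h

p-bigBlocksFrom : ∀ h m → h ≤ m → p m (m ∸ h) ≡ bigBlocksFrom 0 0 m h
p-bigBlocksFrom h m h≤m = begin
    p m j
  ≡⟨ length-filter≡sum (λ s → numBigBlocks s ≟ j) (partitions m) ⟩
    sum (map (blockWeight (λ _ d → χ (d ≟ j))) (partitions m))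
  ≡⟨ sum-map-blockWeight-partitions (λ _ d → χ (d ≟ j)) m ⟩
    extensions (λ _ d → χ (d ≟ j)) 0 0 m
  ≡⟨ extensions-bigBlocksFrom j h 0 0 m (m∸n+n≡m h≤m) ⟩
    bigBlocksFrom 0 0 m h
  ∎
  where
  j = m ∸ h

sumFromTo-∑< : ∀ a b f → sumFromTo a b f ≡ ∑< (suc b ∸ a) (λ t → f (a + t))
sumFromTo-∑< a b f = sum-map-applyUpTo (λ t → f (a + t)) id (suc b ∸ a)

sumFromTo-cong : ∀ a b {f g : ℕ → ℕ} → (∀ i → a ≤ i → f i ≡ g i) → sumFromTo a b f ≡ sumFromTo a b g
sumFromTo-cong a b {f} {g} e = begin
    sumFromTo a b f
  ≡⟨ sumFromTo-∑< a b f ⟩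
    ∑< (suc b ∸ a) (λ t → f (a + t))
  ≡⟨ ∑-cong (suc b ∸ a) (λ t _ → e (a + t) (m≤m+n a t)) ⟩
    ∑< (suc b ∸ a) (λ t → g (a + t))
  ≡⟨ sym (sumFromTo-∑< a b g) ⟩
    sumFromTo a b g
  ∎

binomialTransform-sumFromTo : ∀ n h (f : ℕ → ℕ) → h ≤ suc n → (∀ m → m < h → f m ≡ 0) →
  binomialTransform f n ≡ sumFromTo (h + 1) (suc n) (λ i → (n C (suc n ∸ i)) * f (i ∸ 1))
binomialTransform-sumFromTo n h f h≤1+n zeros = begin
    binomialTransform f n
  ≡⟨ ∑-drop-zeros h (suc n) _ h≤1+n (λ m m<h → trans (cong ((n C m) *_) (zeros m m<h)) (*-zeroʳ (n C m))) ⟩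
    ∑< (suc n ∸ h) (λ t → (n C (h + t)) * f (h + t))
  ≡⟨ ∑-cong (suc n ∸ h) (λ t t<1+n-h → trans (cong (_* f (h + t)) (nCk≡nC[n∸k] (h+t≤n t t<1+n-h)))
                                               (cong G (sym (trans (+-assoc h 1 t) (+-suc h t))))) ⟩
    ∑< (suc (suc n) ∸ suc h) (λ t → G (h + 1 + t))
  ≡⟨ cong (λ x → ∑< (suc (suc n) ∸ x) (λ t → G (h + 1 + t))) (+-comm 1 h) ⟩
    ∑< (suc (suc n) ∸ (h + 1)) (λ t → G (h + 1 + t))
  ≡⟨ sym (sumFromTo-∑< (h + 1) (suc n) G) ⟩
    sumFromTo (h + 1) (suc n) G
  ∎
  where
  G : ℕ → ℕ
  G i = (n C (suc n ∸ i)) * f (i ∸ 1)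
  h+t≤n : ∀ t → t < suc n ∸ h → h + t ≤ n
  h+t≤n t t< = subst (_≤ n) (+-comm t h) (s≤s⁻¹ (m≤o∸n⇒m+n≤o (suc t) h≤1+n t<))

proposition6p4 : (n h : ℕ) → 1 ≤ n → h ≤ n ∸ 1 →
    S n (n ∸ h) ≡ sumFromTo (h + 1) n (λ i → ((n ∸ 1) C (n ∸ i)) * p (i ∸ 1) (i ∸ 1 ∸ h))
proposition6p4 (suc n) h _ h≤n = begin
    S (suc n) (suc n ∸ h)
  ≡⟨ S-stirlingFrom n h h≤1+n ⟩
    stirlingFrom 1 n h
  ≡⟨ sym (binomialTransform-bigBlocksFrom 0 n h) ⟩
    binomialTransform (λ m → bigBlocksFrom 0 0 m h) n
  ≡⟨ binomialTransform-sumFromTo n h _ h≤1+n (λ m → bigBlocksFrom-vanishes 0 0 m h) ⟩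
    sumFromTo (h + 1) (suc n) (λ i → (n C (suc n ∸ i)) * bigBlocksFrom 0 0 (i ∸ 1) h)
  ≡⟨ sumFromTo-cong (h + 1) (suc n) (λ i h+1≤i →
       cong ((n C (suc n ∸ i)) *_) (sym (p-bigBlocksFrom h (i ∸ 1) (m+n≤o⇒m≤o∸n h h+1≤i)))) ⟩
    sumFromTo (h + 1) (suc n) (λ i → (n C (suc n ∸ i)) * p (i ∸ 1) (i ∸ 1 ∸ h))
  ∎
  where
  h≤1+n : h ≤ suc n
  h≤1+n = m≤n⇒m≤1+n h≤n
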